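{- Let $\mathscr{C},\mathscr{D}$ be categories with a dual adjunction $(F,G,\eta)$ as in the context, where $\mathscr{C}$ has binary coproducts and $\mathscr{D}$ has binary products. For $i=1,2$ let $L_i:\mathscr{C}\to\mathscr{C}$ and $T_i:\mathscr{D}\to\mathscr{D}$ be functors and $\delta^i:L_iG\Rightarrow GT_i$ natural transformations. Let $A$ be an object of $\mathscr{C}$ and $\alpha:L_1A+L_2A\to A$ a morphism. Suppose that for $i=1,2$ the adjoint transpose $\hat\delta^i_A:T_iFA\to FL_iA$ has a right inverse $\zeta^i_A:FL_iA\to T_iFA$, i.e. $\hat\delta^i_A\circ\zeta^i_A=\mathrm{id}_{FL_iA}$. Define $\beta:L_1GFA+L_2GFA\to GFA$ by $$\beta=GF\alpha\circ G\langle F\iota_1,F\iota_2\rangle\circ G(\zeta^1_A\times\zeta^2_A)\circ[G\pi_1,G\pi_2]\circ(\delta^1_{FA}+\delta^2_{FA}).$$ Then $\beta\circ(L_1\eta_A+L_2\eta_A)=\eta_A\circ\alpha$; that is, $\eta_A$ is an $(L_1+L_2)$-algebra morphism from $(A,\alpha)$ to $(GFA,\beta)$.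
   Context: A dual adjunction consists of contravariant functors $F:\mathscr{C}\to\mathscr{D}$ and $G:\mathscr{D}\to\mathscr{C}$ together with bijections $\mathscr{C}(A,GX)\cong\mathscr{D}(X,FA)$, natural in $A$ and $X$. This is equivalent to $F\dashv G$ with $F:\mathscr{C}\to\mathscr{D}^{\mathrm{op}}$. For $f:A\to GX$ write $f^\flat:X\to FA$ for the corresponding morphism. The unit $\eta_A:A\to GFA$ corresponds to $\mathrm{id}_{FA}$. Naturality of $\delta^i$ means $GT_ih\circ\delta^i_Y=\delta^i_X\circ L_iGh$ for every $h:X\to Y$ in $\mathscr{D}$. The adjoint transpose is $\hat\delta^i_A:=(\delta^i_{FA}\circ L_i\eta_A)^\flat:T_iFA\to FL_iA$. In the definition of $\beta$: - $\iota_j:L_jA\to L_1A+L_2A$ are the coproduct injections, so $F\iota_j:F(L_1A+L_2A)\to FL_jA$. - $\langle F\iota_1,F\iota_2\rangle:F(L_1A+L_2A)\to FL_1A\times FL_2A$ is the induced map into the product. - $\pi_j:T_1FA\times T_2FA\to T_jFA$ are the projections. - $[G\pi_1,G\pi_2]:GT_1FA+GT_2FA\to G(T_1FA\times T_2FA)$ is the copairing. -}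

module Defs where

open import Level using (Level; _⊔_) renaming (suc to lsuc)
open import Relation.Binary using (Rel; IsEquivalence)

record Category (o ℓ e : Level) : Set (lsuc (o ⊔ ℓ ⊔ e)) where
  infixr 9 _∘_
  infix  4 _≈_
  infixr 4 _⇒_
  field
    Obj       : Set o
    _⇒_       : Obj → Obj → Set ℓ
    _≈_       : ∀ {A B} → Rel (A ⇒ B) e
    id        : ∀ {A} → A ⇒ A
    _∘_       : ∀ {A B C} → B ⇒ C → A ⇒ B → A ⇒ C
    assoc     : ∀ {A B C D} {f : A ⇒ B} {g : B ⇒ C} {h : C ⇒ D} →
                (h ∘ g) ∘ f ≈ h ∘ (g ∘ f)
    identityˡ : ∀ {A B} {f : A ⇒ B} → id ∘ f ≈ f
    identityʳ : ∀ {A B} {f : A ⇒ B} → f ∘ id ≈ f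
    equiv     : ∀ {A B} → IsEquivalence (_≈_ {A} {B})
    ∘-resp-≈  : ∀ {A B C} {f h : B ⇒ C} {g i : A ⇒ B} →
                f ≈ h → g ≈ i → f ∘ g ≈ h ∘ i

record Endofunctor {o ℓ e : Level} (C : Category o ℓ e) : Set (o ⊔ ℓ ⊔ e) where
  open Category C
  field
    F₀           : Obj → Obj
    F₁           : ∀ {A B} → A ⇒ B → F₀ A ⇒ F₀ B
    identity     : ∀ {A} → F₁ (id {A}) ≈ id
    homomorphism : ∀ {A B C} {f : A ⇒ B} {g : B ⇒ C} → F₁ (g ∘ f) ≈ F₁ g ∘ F₁ f
    F-resp-≈     : ∀ {A B} {f g : A ⇒ B} → f ≈ g → F₁ f ≈ F₁ g

record ContraFunctor {o ℓ e o' ℓ' e' : Level}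
       (C : Category o ℓ e) (D : Category o' ℓ' e') : Set (o ⊔ ℓ ⊔ e ⊔ o' ⊔ ℓ' ⊔ e') where
  private
    module C = Category C
    module D = Category D
  field
    F₀           : C.Obj → D.Obj
    F₁           : ∀ {A B} → A C.⇒ B → F₀ B D.⇒ F₀ A
    identity     : ∀ {A} → F₁ (C.id {A}) D.≈ D.id
    homomorphism : ∀ {A B E} {f : A C.⇒ B} {g : B C.⇒ E} →
                   F₁ (g C.∘ f) D.≈ F₁ f D.∘ F₁ g
    F-resp-≈     : ∀ {A B} {f g : A C.⇒ B} → f C.≈ g → F₁ f D.≈ F₁ g

record DualAdjunction {o ℓ e o' ℓ' e' : Level}
       (C : Category o ℓ e) (D : Category o' ℓ' e') : Set (o ⊔ ℓ ⊔ e ⊔ o' ⊔ ℓ' ⊔ e') where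
  private
    module C = Category C
    module D = Category D
  field
    F : ContraFunctor C D
    G : ContraFunctor D C
  private
    module F = ContraFunctor F
    module G = ContraFunctor G
  field
    flat         : ∀ {A X} → A C.⇒ G.F₀ X → X D.⇒ F.F₀ A
    sharp        : ∀ {A X} → X D.⇒ F.F₀ A → A C.⇒ G.F₀ X
    flat-sharp   : ∀ {A X} {g : X D.⇒ F.F₀ A} → flat (sharp g) D.≈ g
    sharp-flat   : ∀ {A X} {f : A C.⇒ G.F₀ X} → sharp (flat f) C.≈ f
    flat-resp-≈  : ∀ {A X} {f f' : A C.⇒ G.F₀ X} → f C.≈ f' → flat f D.≈ flat f'
    sharp-resp-≈ : ∀ {A X} {g g' : X D.⇒ F.F₀ A} → g D.≈ g' → sharp g C.≈ sharp g'
    flat-natural : ∀ {A A' X X'} {f : A C.⇒ G.F₀ X} {a : A' C.⇒ A} {h : X' D.⇒ X} →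
                   flat (G.F₁ h C.∘ f C.∘ a) D.≈ F.F₁ a D.∘ flat f D.∘ h

  η : ∀ {A} → A C.⇒ G.F₀ (F.F₀ A)
  η = sharp D.id

record DualNat {o ℓ e o' ℓ' e' : Level} {C : Category o ℓ e} {D : Category o' ℓ' e'}
       (adj : DualAdjunction C D) (L : Endofunctor C) (T : Endofunctor D)
       : Set (o ⊔ ℓ ⊔ e ⊔ o' ⊔ ℓ' ⊔ e') where
  private
    module C = Category C
    module D = Category D
    module L = Endofunctor L
    module T = Endofunctor T
    module G = ContraFunctor (DualAdjunction.G adj)
  field
    component : ∀ X → L.F₀ (G.F₀ X) C.⇒ G.F₀ (T.F₀ X)
    commute   : ∀ {X Y} (h : X D.⇒ Y) →
                G.F₁ (T.F₁ h) C.∘ component Y C.≈ component X C.∘ L.F₁ (G.F₁ h)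

record BinaryCoproducts {o ℓ e : Level} (C : Category o ℓ e) : Set (o ⊔ ℓ ⊔ e) where
  open Category C
  infixr 6 _+_
  field
    _+_     : Obj → Obj → Obj
    ι₁      : ∀ {A B} → A ⇒ A + B
    ι₂      : ∀ {A B} → B ⇒ A + B
    [_,_]   : ∀ {A B E} → A ⇒ E → B ⇒ E → A + B ⇒ E
    inject₁ : ∀ {A B E} {f : A ⇒ E} {g : B ⇒ E} → [ f , g ] ∘ ι₁ ≈ f
    inject₂ : ∀ {A B E} {f : A ⇒ E} {g : B ⇒ E} → [ f , g ] ∘ ι₂ ≈ g
    unique  : ∀ {A B E} {f : A ⇒ E} {g : B ⇒ E} {h : A + B ⇒ E} →
              h ∘ ι₁ ≈ f → h ∘ ι₂ ≈ g → [ f , g ] ≈ h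

  _+₁_ : ∀ {A B A' B'} → A ⇒ B → A' ⇒ B' → A + A' ⇒ B + B'
  f +₁ g = [ ι₁ ∘ f , ι₂ ∘ g ]

record BinaryProducts {o ℓ e : Level} (C : Category o ℓ e) : Set (o ⊔ ℓ ⊔ e) where
  open Category C
  infixr 7 _×_
  field
    _×_      : Obj → Obj → Obj
    π₁       : ∀ {A B} → A × B ⇒ A
    π₂       : ∀ {A B} → A × B ⇒ B
    ⟨_,_⟩    : ∀ {A B E} → E ⇒ A → E ⇒ B → E ⇒ A × B
    project₁ : ∀ {A B E} {f : E ⇒ A} {g : E ⇒ B} → π₁ ∘ ⟨ f , g ⟩ ≈ f
    project₂ : ∀ {A B E} {f : E ⇒ A} {g : E ⇒ B} → π₂ ∘ ⟨ f , g ⟩ ≈ g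
    unique   : ∀ {A B E} {f : E ⇒ A} {g : E ⇒ B} {h : E ⇒ A × B} →
               π₁ ∘ h ≈ f → π₂ ∘ h ≈ g → ⟨ f , g ⟩ ≈ h

  _×₁_ : ∀ {A B A' B'} → A ⇒ B → A' ⇒ B' → A × A' ⇒ B × B'
  f ×₁ g = ⟨ f ∘ π₁ , g ∘ π₂ ⟩

module _ {o ℓ e o' ℓ' e' : Level} {C : Category o ℓ e} {D : Category o' ℓ' e'}
         (adj : DualAdjunction C D) where
  private
    module C = Category C
    module D = Category D
    module Adj = DualAdjunction adj
    module F = ContraFunctor Adj.F
    module G = ContraFunctor Adj.G

  δ̂ : {L : Endofunctor C} {T : Endofunctor D} → DualNat adj L T →
       (A : C.Obj) → Endofunctor.F₀ T (F.F₀ A) D.⇒ F.F₀ (Endofunctor.F₀ L A)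
  δ̂ {L} δ A = Adj.flat (DualNat.component δ (F.F₀ A) C.∘ Endofunctor.F₁ L (Adj.η {A}))

  β : (cop : BinaryCoproducts C) (prod : BinaryProducts D)
      {L₁ L₂ : Endofunctor C} {T₁ T₂ : Endofunctor D}
      (δ¹ : DualNat adj L₁ T₁) (δ² : DualNat adj L₂ T₂)
      (A : C.Obj) →
      BinaryCoproducts._+_ cop (Endofunctor.F₀ L₁ A) (Endofunctor.F₀ L₂ A) C.⇒ A →
      F.F₀ (Endofunctor.F₀ L₁ A) D.⇒ Endofunctor.F₀ T₁ (F.F₀ A) →
      F.F₀ (Endofunctor.F₀ L₂ A) D.⇒ Endofunctor.F₀ T₂ (F.F₀ A) →
      BinaryCoproducts._+_ cop (Endofunctor.F₀ L₁ (G.F₀ (F.F₀ A)))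
                               (Endofunctor.F₀ L₂ (G.F₀ (F.F₀ A)))
        C.⇒ G.F₀ (F.F₀ A)
  β cop prod δ¹ δ² A α ζ¹ ζ² =
    G.F₁ (F.F₁ α) C.∘ G.F₁ P.⟨ F.F₁ S.ι₁ , F.F₁ S.ι₂ ⟩ C.∘ G.F₁ (ζ¹ P.×₁ ζ²)
      C.∘ S.[ G.F₁ P.π₁ , G.F₁ P.π₂ ]
      C.∘ (DualNat.component δ¹ (F.F₀ A) S.+₁ DualNat.component δ² (F.F₀ A))
    where
      module S = BinaryCoproducts cop
      module P = BinaryProducts prod

module Submission where

-- Two morphisms out of L₁A + L₂A agree once they agree on both
-- injections, so it suffices to compare β ∘ (L₁η + L₂η) and η ∘ α on L_jA.
-- Pushing the injection ι_j through the coproduct part of β leaves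
--   GFα ∘ G⟨Fι₁,Fι₂⟩ ∘ G(ζ¹ × ζ²) ∘ Gπ_j ∘ (δʲ_{FA} ∘ L_jη).
-- Since π_j ∘ (ζ¹ × ζ²) = ζʲ ∘ π_j, the factor Gζʲ meets δʲ_{FA} ∘ L_jη, whose
-- transpose is δ̂ʲ; as ζʲ is a right inverse of δ̂ʲ this composite is the unit
-- η_{L_jA}.  What remains is GFα ∘ GFι_j ∘ η = η ∘ α ∘ ι_j by naturality of η.

open import Level using (Level)
open import Relation.Binary using (Setoid; IsEquivalence)
import Relation.Binary.Reasoning.Setoid as SetoidReasoning

open import Defs

module CategoryLemmas {o ℓ e : Level} (C : Category o ℓ e) where
  open Category C

  hom-setoid : (X Y : Obj) → Setoid ℓ e
  hom-setoid X Y = record { Carrier = X ⇒ Y ; _≈_ = _≈_ ; isEquivalence = equiv }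

  module HomReasoning {X Y : Obj} = SetoidReasoning (hom-setoid X Y)

  open module Equiv {X Y : Obj} = IsEquivalence (equiv {X} {Y}) public
    using (refl; sym; trans)

  infixr 4 refl⟩∘⟨_
  infixl 5 _⟩∘⟨refl

  refl⟩∘⟨_ : ∀ {X Y Z} {f : Y ⇒ Z} {g h : X ⇒ Y} → g ≈ h → f ∘ g ≈ f ∘ h
  refl⟩∘⟨ e = ∘-resp-≈ refl e

  _⟩∘⟨refl : ∀ {X Y Z} {f g : Y ⇒ Z} {h : X ⇒ Y} → f ≈ g → f ∘ h ≈ g ∘ h
  e ⟩∘⟨refl = ∘-resp-≈ e refl

  pullˡ : ∀ {W X Y Z} {f : Y ⇒ Z} {g : X ⇒ Y} {h : X ⇒ Z} {k : W ⇒ X} →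
          f ∘ g ≈ h → f ∘ (g ∘ k) ≈ h ∘ k
  pullˡ e = trans (sym assoc) (e ⟩∘⟨refl)

  extend : ∀ {W X Y Y' Z} {f : Y ⇒ Z} {g : X ⇒ Y} {h : Y' ⇒ Z} {i : X ⇒ Y'} {k : W ⇒ X} →
           f ∘ g ≈ h ∘ i → f ∘ (g ∘ k) ≈ h ∘ (i ∘ k)
  extend e = trans (pullˡ e) assoc

module ContraFunctorLemmas {o ℓ e o' ℓ' e' : Level} {C : Category o ℓ e} {D : Category o' ℓ' e'}
                           (G : ContraFunctor D C) where
  private
    module D = Category D
  open Category C
  open CategoryLemmas C
  open ContraFunctor G

  triangle : ∀ {X Y Z} {p : Y D.⇒ Z} {q : X D.⇒ Y} {r : X D.⇒ Z} →
             p D.∘ q D.≈ r → F₁ q ∘ F₁ p ≈ F₁ r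
  triangle e = trans (sym homomorphism) (F-resp-≈ e)

  square : ∀ {X Y Y' Z} {p : Y D.⇒ Z} {q : X D.⇒ Y} {r : Y' D.⇒ Z} {s : X D.⇒ Y'} →
           p D.∘ q D.≈ r D.∘ s → F₁ q ∘ F₁ p ≈ F₁ s ∘ F₁ r
  square e = trans (triangle e) homomorphism

module CoproductLemmas {o ℓ e : Level} {C : Category o ℓ e} (cop : BinaryCoproducts C) where
  open Category C
  open CategoryLemmas C
  open BinaryCoproducts cop

  []-cong : ∀ {A B E} {f f' : A ⇒ E} {g g' : B ⇒ E} → f ≈ f' → g ≈ g' → [ f , g ] ≈ [ f' , g' ]
  []-cong e₁ e₂ = sym (unique (trans inject₁ e₁) (trans inject₂ e₂))

  []-η : ∀ {A B E} {h : A + B ⇒ E} → [ h ∘ ι₁ , h ∘ ι₂ ] ≈ h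
  []-η = unique refl refl

  ∘-[] : ∀ {A B E E'} {h : E ⇒ E'} {f : A ⇒ E} {g : B ⇒ E} → h ∘ [ f , g ] ≈ [ h ∘ f , h ∘ g ]
  ∘-[] = sym (unique (trans assoc (refl⟩∘⟨ inject₁)) (trans assoc (refl⟩∘⟨ inject₂)))

  []-+₁ : ∀ {A B A' B' E} {f : A' ⇒ E} {g : B' ⇒ E} {h : A ⇒ A'} {k : B ⇒ B'} →
          [ f , g ] ∘ (h +₁ k) ≈ [ f ∘ h , g ∘ k ]
  []-+₁ = sym (unique (trans assoc (trans (refl⟩∘⟨ inject₁) (pullˡ inject₁)))
                      (trans assoc (trans (refl⟩∘⟨ inject₂) (pullˡ inject₂))))

module DualAdjunctionLemmas {o ℓ e o' ℓ' e' : Level} {C : Category o ℓ e} {D : Category o' ℓ' e'}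
                            (adj : DualAdjunction C D) where
  private
    module D = Category D
    module DL = CategoryLemmas D
  open Category C
  open CategoryLemmas C
  open DualAdjunction adj
  module F = ContraFunctor F
  module G = ContraFunctor G
  open ContraFunctorLemmas G

  flat-injective : ∀ {B X} {f g : B ⇒ G.F₀ X} → flat f D.≈ flat g → f ≈ g
  flat-injective e = trans (sym sharp-flat) (trans (sharp-resp-≈ e) sharp-flat)

  flat-η : ∀ {B} → flat (η {B}) D.≈ D.id
  flat-η = flat-sharp

  flat-G : ∀ {B X Y} {h : Y D.⇒ X} {f : B ⇒ G.F₀ X} → flat (G.F₁ h ∘ f) D.≈ flat f D.∘ h
  flat-G = DL.trans (flat-resp-≈ (refl⟩∘⟨ sym identityʳ))
             (DL.trans flat-natural (DL.trans (F.identity DL.⟩∘⟨refl) D.identityˡ))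

  flat-precomp : ∀ {B B' X} {f : B ⇒ G.F₀ X} {a : B' ⇒ B} → flat (f ∘ a) D.≈ F.F₁ a D.∘ flat f
  flat-precomp = DL.trans (flat-resp-≈ (sym (trans (G.identity ⟩∘⟨refl) identityˡ)))
                   (DL.trans flat-natural (DL.refl⟩∘⟨ D.identityʳ))

  -- The unit is natural: both sides transpose to F a.
  η-natural : ∀ {B B'} (a : B' ⇒ B) → G.F₁ (F.F₁ a) ∘ η {B'} ≈ η {B} ∘ a
  η-natural a = flat-injective (DL.trans flat-G (DL.trans (flat-η DL.⟩∘⟨refl)
                  (DL.trans D.identityˡ (DL.sym (DL.trans flat-precomp
                    (DL.trans (DL.refl⟩∘⟨ flat-η) D.identityʳ))))))

  section-unit : ∀ {B X} {f : B ⇒ G.F₀ X} {ζ : F.F₀ B D.⇒ X} →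
                 flat f D.∘ ζ D.≈ D.id → G.F₁ ζ ∘ f ≈ η
  section-unit sec = flat-injective (DL.trans flat-G (DL.trans sec (DL.sym flat-η)))

  -- The computation of β on one summand, stated for arbitrary morphisms
  -- satisfying the triangle and square that the product structure provides:
  --   GFa ∘ Gu ∘ Gs ∘ Gp ∘ f = η ∘ a ∘ ι.
  summand : ∀ {B B' Bₐ} {X Y Z : D.Obj} {a : B ⇒ Bₐ} {ι : B' ⇒ B}
              {u : F.F₀ B D.⇒ Y} {s : Y D.⇒ X} {p : X D.⇒ Z}
              {q : Y D.⇒ F.F₀ B'} {ζ : F.F₀ B' D.⇒ Z} {f : B' ⇒ G.F₀ Z} →
            q D.∘ u D.≈ F.F₁ ι → p D.∘ s D.≈ ζ D.∘ q → flat f D.∘ ζ D.≈ D.id →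
            (G.F₁ (F.F₁ a) ∘ (G.F₁ u ∘ G.F₁ s)) ∘ (G.F₁ p ∘ f) ≈ η ∘ (a ∘ ι)
  summand {a = a} {ι} {u} {s} {p} {q} {ζ} {f} tri sq sec = begin
      (G.F₁ (F.F₁ a) ∘ (G.F₁ u ∘ G.F₁ s)) ∘ (G.F₁ p ∘ f)
    ≈⟨ trans assoc (refl⟩∘⟨ assoc) ⟩
      G.F₁ (F.F₁ a) ∘ (G.F₁ u ∘ (G.F₁ s ∘ (G.F₁ p ∘ f)))
    ≈⟨ refl⟩∘⟨ refl⟩∘⟨ extend (square sq) ⟩
      G.F₁ (F.F₁ a) ∘ (G.F₁ u ∘ (G.F₁ q ∘ (G.F₁ ζ ∘ f)))
    ≈⟨ refl⟩∘⟨ refl⟩∘⟨ refl⟩∘⟨ section-unit sec ⟩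
      G.F₁ (F.F₁ a) ∘ (G.F₁ u ∘ (G.F₁ q ∘ η))
    ≈⟨ refl⟩∘⟨ pullˡ (triangle tri) ⟩
      G.F₁ (F.F₁ a) ∘ (G.F₁ (F.F₁ ι) ∘ η)
    ≈⟨ pullˡ (triangle (DL.sym F.homomorphism)) ⟩
      G.F₁ (F.F₁ (a ∘ ι)) ∘ η
    ≈⟨ η-natural (a ∘ ι) ⟩
      η ∘ (a ∘ ι)
    ∎
    where open HomReasoning

theorem6 : {o ℓ e o' ℓ' e' : Level} {C : Category o ℓ e} {D : Category o' ℓ' e'}
           (adj : DualAdjunction C D)
           (cop : BinaryCoproducts C) (prod : BinaryProducts D)
           (L₁ L₂ : Endofunctor C) (T₁ T₂ : Endofunctor D)
           (δ¹ : DualNat adj L₁ T₁) (δ² : DualNat adj L₂ T₂)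
           (A : Category.Obj C)
           (α : Category._⇒_ C (BinaryCoproducts._+_ cop (Endofunctor.F₀ L₁ A) (Endofunctor.F₀ L₂ A)) A)
           (ζ¹ : Category._⇒_ D (ContraFunctor.F₀ (DualAdjunction.F adj) (Endofunctor.F₀ L₁ A))
                                (Endofunctor.F₀ T₁ (ContraFunctor.F₀ (DualAdjunction.F adj) A)))
           (ζ² : Category._⇒_ D (ContraFunctor.F₀ (DualAdjunction.F adj) (Endofunctor.F₀ L₂ A))
                                (Endofunctor.F₀ T₂ (ContraFunctor.F₀ (DualAdjunction.F adj) A))) →
           Category._≈_ D (Category._∘_ D (δ̂ adj δ¹ A) ζ¹) (Category.id D) →
           Category._≈_ D (Category._∘_ D (δ̂ adj δ² A) ζ²) (Category.id D) →
           Category._≈_ C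
             (Category._∘_ C (β adj cop prod δ¹ δ² A α ζ¹ ζ²)
                (BinaryCoproducts._+₁_ cop (Endofunctor.F₁ L₁ (DualAdjunction.η adj {A}))
                                           (Endofunctor.F₁ L₂ (DualAdjunction.η adj {A}))))
             (Category._∘_ C (DualAdjunction.η adj {A}) α)
theorem6 {C = C} adj cop prod L₁ L₂ T₁ T₂ δ¹ δ² A α ζ¹ ζ² sec₁ sec₂ = begin
    β adj cop prod δ¹ δ² A α ζ¹ ζ² ∘ (L₁η +₁ L₂η)
  ≈⟨ trans (trans (refl⟩∘⟨ sym assoc) (sym assoc) ⟩∘⟨refl) assoc ⟩
    M ∘ ([ G.F₁ P.π₁ , G.F₁ P.π₂ ] ∘ (δ₁ +₁ δ₂)) ∘ (L₁η +₁ L₂η)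
  ≈⟨ refl⟩∘⟨ trans ([]-+₁ ⟩∘⟨refl) []-+₁ ⟩
    M ∘ [ (G.F₁ P.π₁ ∘ δ₁) ∘ L₁η , (G.F₁ P.π₂ ∘ δ₂) ∘ L₂η ]
  ≈⟨ ∘-[] ⟩
    [ M ∘ ((G.F₁ P.π₁ ∘ δ₁) ∘ L₁η) , M ∘ ((G.F₁ P.π₂ ∘ δ₂) ∘ L₂η) ]
  ≈⟨ []-cong (trans (refl⟩∘⟨ assoc) (summand P.project₁ P.project₁ sec₁))
             (trans (refl⟩∘⟨ assoc) (summand P.project₂ P.project₂ sec₂)) ⟩
    [ η ∘ (α ∘ ι₁) , η ∘ (α ∘ ι₂) ]
  ≈⟨ sym ∘-[] ⟩
    η ∘ [ α ∘ ι₁ , α ∘ ι₂ ]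
  ≈⟨ refl⟩∘⟨ []-η ⟩
    η ∘ α
  ∎
  where
    open Category C
    open CategoryLemmas C
    open HomReasoning
    open BinaryCoproducts cop
    open CoproductLemmas cop
    module P = BinaryProducts prod
    open DualAdjunctionLemmas adj
    open DualAdjunction adj using (η)

    module L₁ = Endofunctor L₁
    module L₂ = Endofunctor L₂
    module T₁ = Endofunctor T₁
    module T₂ = Endofunctor T₂

    L₁η : L₁.F₀ A ⇒ L₁.F₀ (G.F₀ (F.F₀ A))
    L₁η = L₁.F₁ η
    L₂η : L₂.F₀ A ⇒ L₂.F₀ (G.F₀ (F.F₀ A))
    L₂η = L₂.F₁ η
    δ₁ : L₁.F₀ (G.F₀ (F.F₀ A)) ⇒ G.F₀ (T₁.F₀ (F.F₀ A))
    δ₁ = DualNat.component δ¹ (F.F₀ A)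
    δ₂ : L₂.F₀ (G.F₀ (F.F₀ A)) ⇒ G.F₀ (T₂.F₀ (F.F₀ A))
    δ₂ = DualNat.component δ² (F.F₀ A)

    M : G.F₀ (T₁.F₀ (F.F₀ A) P.× T₂.F₀ (F.F₀ A)) ⇒ G.F₀ (F.F₀ A)
    M = G.F₁ (F.F₁ α) ∘ (G.F₁ P.⟨ F.F₁ ι₁ , F.F₁ ι₂ ⟩ ∘ G.F₁ (ζ¹ P.×₁ ζ²))
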